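{- Let $\Sigma$ be a finite vocabulary including the property name $r$, let $m$ be a natural number, and let $G=G_{\mathit{disj}}(\Sigma,m)$ and $G'=G'_{\mathit{disj}}(\Sigma,m)$, with common set of nodes $V$. Let $\phi$ be a shape over $\Sigma$ that does not use $\mathit{disj}$ and that counts to at most $m$. Then either $[\![\phi]\!]^G\cap V=\emptyset$ or $[\![\phi]\!]^G\supseteq V$. Moreover, $[\![\phi]\!]^G=[\![\phi]\!]^{G'}$.
   Context: Fix two disjoint infinite sets $N$ (node names/constants) and $P$ (property names). Path expressions: $E ::= \mathit{id} \mid p \mid p^- \mid E\cup E \mid E\circ E \mid E^*$, $p\in P$. Shapes: $\phi ::= \top \mid \{c\} \mid \phi\land\phi \mid \phi\lor\phi \mid \neg\phi \mid {\geq_n E}.\phi \mid \mathit{eq}(E,p) \mid \mathit{disj}(E,p) \mid \mathit{closed}(R)$, with $c\in N$, integer $n\geq1$, $p\in P$, $R$ a finite subset of $P$. A graph is a finite set of triples $(a,p,b)$, $a,b\in N$, $p\in P$. Semantics (domain $N$): $[\![p]\!]^G=\{(a,b):(a,p,b)\in G\}$, $\mathit{id}$ identity on $N$, $p^-$ inverse, $\cup$ union, $\circ$ composition, $E^*$ reflexive-transitive closure on $N$; $R(x)=\{y:(x,y)\in R\}$. $G,a\models\top$ always; $G,a\models\{c\}$ iff $a=c$; boolean connectives as usual; $G,a\models{\geq_nE}.\psi$ iff at least $n$ elements $b\in[\![E]\!]^G(a)$ have $G,b\models\psi$; $G,a\models\mathit{eq}(E,p)$ iff $[\![E]\!]^G(a)=[\![p]\!]^G(a)$;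 $G,a\models\mathit{disj}(E,p)$ iff these are disjoint; $G,a\models\mathit{closed}(R)$ iff $[\![p]\!]^G(a)=\emptyset$ for all $p\in P\setminus R$. $[\![\phi]\!]^G=\{a\in N:G,a\models\phi\}$. A vocabulary is $\Sigma\subseteq N\cup P$; a shape is over $\Sigma$ if its constants and property names lie in $\Sigma$; it counts to at most $m$ if every ${\geq_n}$ in it has $n\le m$. Graph $G_{\mathit{disj}}(\Sigma,m)$: let $M=\max(m,3)$ and take $4M$ distinct node names $x_i^j$ ($i\in\{1,2,3,4\}$, $j\in\{1,\dots,M\}$) not in $\Sigma$; for each property name $p\in\Sigma\cap P$ it contains the triples $(x_i^j,p,x_{i\bmod 4+1}^{j'})$ for all $i,j,j'$, and $(x_i^j,p,x_i^{j'})$ for all $i\in\{2,4\}$ and $j\neq j'$; there are no other triples. $G'_{\mathit{disj}}(\Sigma,m)$ is defined the same way except that $(x_i^j,p,x_i^{j'})$ is included for all $i\in\{1,2,3,4\}$ and $j\neq j'$. -}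

module Defs where

open import Data.Nat using (ℕ; _≤_; _⊔_)
open import Data.Fin using (Fin; zero; suc)
open import Data.List using (List)
open import Data.List.Membership.Propositional using (_∈_; _∉_)
open import Data.Sum using (_⊎_; inj₁; inj₂)
open import Data.Product using (_×_; Σ; ∃; ∃-syntax; _,_)
open import Data.Unit using (⊤)
open import Data.Empty using (⊥)
open import Relation.Nullary using (¬_)
open import Relation.Binary.PropositionalEquality using (_≡_; _≢_)
open import Function.Definitions using (Injective)
open import Function.Bundles using (_⇔_)

record Node : Set where
  constructor node
  field nodeId : ℕ

record Prop : Set where
  constructor prop
  field propId : ℕ

Graph : Set₁
Graph = Node → Prop → Node → Set

data Path : Set where
  pid   : Path
  pp    : Prop → Path
  pinv  : Prop → Path
  _∪ₚ_  : Path → Path → Path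
  _∘ₚ_  : Path → Path → Path
  _*ₚ   : Path → Path

data Shape : Set where
  top    : Shape
  const  : Node → Shape
  _∧ₛ_   : Shape → Shape → Shape
  _∨ₛ_   : Shape → Shape → Shape
  notₛ   : Shape → Shape
  geq    : (n : ℕ) → 1 ≤ n → Path → Shape → Shape
  eqₛ    : Path → Prop → Shape
  disjₛ  : Path → Prop → Shape
  closed : List Prop → Shape

data ⟦_⟧ (G : Graph) : Path → Node → Node → Set where
  s-id    : ∀ {a} → ⟦ G ⟧ pid a a
  s-prop  : ∀ {a p b} → G a p b → ⟦ G ⟧ (pp p) a b
  s-inv   : ∀ {a p b} → G b p a → ⟦ G ⟧ (pinv p) a b
  s-∪ˡ    : ∀ {E F a b} → ⟦ G ⟧ E a b → ⟦ G ⟧ (E ∪ₚ F) a b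
  s-∪ʳ    : ∀ {E F a b} → ⟦ G ⟧ F a b → ⟦ G ⟧ (E ∪ₚ F) a b
  s-∘     : ∀ {E F a b c} → ⟦ G ⟧ E a b → ⟦ G ⟧ F b c → ⟦ G ⟧ (E ∘ₚ F) a c
  s-refl  : ∀ {E a} → ⟦ G ⟧ (E *ₚ) a a
  s-step  : ∀ {E a b c} → ⟦ G ⟧ E a b → ⟦ G ⟧ (E *ₚ) b c → ⟦ G ⟧ (E *ₚ) a c

Sat : Graph → Node → Shape → Set
Sat G a top          = ⊤
Sat G a (const c)    = a ≡ c
Sat G a (φ ∧ₛ ψ)     = Sat G a φ × Sat G a ψ
Sat G a (φ ∨ₛ ψ)     = Sat G a φ ⊎ Sat G a ψ
Sat G a (notₛ φ)     = ¬ Sat G a φ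
Sat G a (geq n _ E ψ) =
  Σ (Fin n → Node) λ f → Injective _≡_ _≡_ f × (∀ k → ⟦ G ⟧ E a (f k) × Sat G (f k) ψ)
Sat G a (eqₛ E p)    = ∀ b → ⟦ G ⟧ E a b ⇔ G a p b
Sat G a (disjₛ E p)  = ∀ b → ⟦ G ⟧ E a b → G a p b → ⊥
Sat G a (closed R)   = ∀ p b → p ∉ R → ¬ G a p b

Vocab : Set
Vocab = List (Node ⊎ Prop)

PathOver : Vocab → Path → Set
PathOver Σ' pid       = ⊤
PathOver Σ' (pp p)    = inj₂ p ∈ Σ'
PathOver Σ' (pinv p)  = inj₂ p ∈ Σ'
PathOver Σ' (E ∪ₚ F)  = PathOver Σ' E × PathOver Σ' F
PathOver Σ' (E ∘ₚ F)  = PathOver Σ' E × PathOver Σ' F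
PathOver Σ' (E *ₚ)    = PathOver Σ' E

PropsIn : Vocab → List Prop → Set
PropsIn Σ' R = ∀ {p} → p ∈ R → inj₂ p ∈ Σ'

ShapeOver : Vocab → Shape → Set
ShapeOver Σ' top            = ⊤
ShapeOver Σ' (const c)      = inj₁ c ∈ Σ'
ShapeOver Σ' (φ ∧ₛ ψ)       = ShapeOver Σ' φ × ShapeOver Σ' ψ
ShapeOver Σ' (φ ∨ₛ ψ)       = ShapeOver Σ' φ × ShapeOver Σ' ψ
ShapeOver Σ' (notₛ φ)       = ShapeOver Σ' φ
ShapeOver Σ' (geq n _ E ψ)  = PathOver Σ' E × ShapeOver Σ' ψ
ShapeOver Σ' (eqₛ E p)      = PathOver Σ' E × inj₂ p ∈ Σ'
ShapeOver Σ' (disjₛ E p)    = PathOver Σ' E × inj₂ p ∈ Σ'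
ShapeOver Σ' (closed R)     = PropsIn Σ' R

CountsAtMost : ℕ → Shape → Set
CountsAtMost m top            = ⊤
CountsAtMost m (const c)      = ⊤
CountsAtMost m (φ ∧ₛ ψ)       = CountsAtMost m φ × CountsAtMost m ψ
CountsAtMost m (φ ∨ₛ ψ)       = CountsAtMost m φ × CountsAtMost m ψ
CountsAtMost m (notₛ φ)       = CountsAtMost m φ
CountsAtMost m (geq n _ E ψ)  = n ≤ m × CountsAtMost m ψ
CountsAtMost m (eqₛ E p)      = ⊤
CountsAtMost m (disjₛ E p)    = ⊤
CountsAtMost m (closed R)     = ⊤

NoDisj : Shape → Set
NoDisj top            = ⊤
NoDisj (const c)      = ⊤
NoDisj (φ ∧ₛ ψ)       = NoDisj φ × NoDisj ψ
NoDisj (φ ∨ₛ ψ)       = NoDisj φ × NoDisj ψ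
NoDisj (notₛ φ)       = NoDisj φ
NoDisj (geq n _ E ψ)  = NoDisj ψ
NoDisj (eqₛ E p)      = ⊤
NoDisj (disjₛ E p)    = ⊥
NoDisj (closed R)     = ⊤

-- The construction of G_disj(Σ,m) and G'_disj(Σ,m).
-- Index i ∈ {1,2,3,4} is represented by Fin 4 (0-based: zero ↔ 1, …, 3 ↔ 4).
-- i mod 4 + 1 :
nextIdx : Fin 4 → Fin 4
nextIdx zero                   = suc zero
nextIdx (suc zero)             = suc (suc zero)
nextIdx (suc (suc zero))       = suc (suc (suc zero))
nextIdx (suc (suc (suc zero))) = zero

-- i ∈ {2,4}  (1-based), i.e. 0-based indices 1 and 3
EvenIdx : Fin 4 → Set
EvenIdx i = (i ≡ suc zero) ⊎ (i ≡ suc (suc (suc zero)))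

M : ℕ → ℕ
M m = m ⊔ 3

FreshNames : Vocab → ℕ → Set
FreshNames Σ' m =
  Σ (Fin 4 → Fin (M m) → Node) λ x →
    (∀ i j i' j' → x i j ≡ x i' j' → (i ≡ i') × (j ≡ j'))
    × (∀ i j → inj₁ (x i j) ∉ Σ')

module _ {Σ' : Vocab} {m : ℕ} (x : Fin 4 → Fin (M m) → Node) where

  Gdisj : Graph
  Gdisj a p b = inj₂ p ∈ Σ' ×
    ((∃[ i ] ∃[ j ] ∃[ j' ] (a ≡ x i j × b ≡ x (nextIdx i) j'))
     ⊎ (∃[ i ] ∃[ j ] ∃[ j' ] (EvenIdx i × j ≢ j' × a ≡ x i j × b ≡ x i j')))

  Gdisj' : Graph
  Gdisj' a p b = inj₂ p ∈ Σ' ×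
    ((∃[ i ] ∃[ j ] ∃[ j' ] (a ≡ x i j × b ≡ x (nextIdx i) j'))
     ⊎ (∃[ i ] ∃[ j ] ∃[ j' ] (j ≢ j' × a ≡ x i j × b ≡ x i j')))

-- All properties of Σ have the same edges, in both graphs.  At a fresh node a, a path
-- expression E therefore only matters through the kinds of words in its language: the empty
-- word, the letter p, the letter p⁻, or a word of length at least two.  Every node has edges to
-- the whole next layer, and inside an even layer to all other nodes of that layer; hence any
-- two steps reach two whole consecutive layers, and so a word of length at least two reaches
-- from a either a itself or a node that is not a p-successor of a.  Consequently eq(E,p) holds
-- at a fresh node iff p is the only word kind of E, and ≥ₙE.ψ holds iff ψ holds at the fresh
-- nodes and either E can move (then E(a) contains a whole layer of M ≥ n nodes) or n = 1.
-- These criteria mention neither the node nor the graph.  Off the fresh nodes neither graph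
-- has any edge, so the two graphs agree there as well.
module Submission where

open import Defs
open import Data.Nat using (ℕ)
open import Data.Fin using (Fin)
open import Data.Sum using (_⊎_; inj₂)
open import Data.Product using (_×_; _,_)
open import Data.List.Membership.Propositional using (_∈_)
open import Relation.Nullary using (¬_)
open import Function.Bundles using (_⇔_)

open import Data.Nat as ℕ using (suc; _≤_; s≤s; z≤n)
open import Data.Nat.Properties using (≤-trans; n≤1+n; m≤n⊔m; m≤m⊔n)
open import Data.Fin using (zero; suc; inject≤; _≟_)
open import Data.Fin.Properties using (inject≤-injective; any?)
open import Data.Sum using (inj₁)
open import Data.Sum.Function.Propositional using (_⊎-⇔_)
open import Data.Product using (Σ; ∃; ∃₂; proj₁; proj₂; map₂)
open import Data.Product.Function.NonDependent.Propositional using (_×-⇔_)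
open import Data.List using (List)
open import Data.List.Membership.Propositional using (_∉_)
open import Data.List.Membership.DecPropositional using (_∈?_)
open import Data.List.Relation.Unary.All as All using (All)
open import Data.Unit using (⊤; tt)
open import Data.Empty using (⊥; ⊥-elim)
open import Relation.Nullary using (Dec; yes; no)
open import Relation.Nullary.Decidable using (map′; ¬?; _×-dec_; _⊎-dec_)
open import Relation.Binary.Definitions using (DecidableEquality)
open import Relation.Binary.PropositionalEquality
  using (_≡_; _≢_; refl; sym; trans; cong; subst; ≢-sym)
open import Function.Bundles using (mk⇔; Equivalence)
open import Function.Definitions using (Injective)
open import Function.Related.TypeIsomorphisms using (¬-cong-⇔)
import Function.Properties.Equivalence as ⇔

_≟ₙ_ : DecidableEquality Node
node a ≟ₙ node b = map′ (cong node) (cong Node.nodeId) (a ℕ.≟ b)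

_≟ₚ_ : DecidableEquality Prop
prop a ≟ₚ prop b = map′ (cong prop) (cong Prop.propId) (a ℕ.≟ b)

another : ∀ {n} → 2 ≤ n → (j : Fin n) → ∃ λ j′ → j ≢ j′
another (s≤s (s≤s _)) zero    = suc zero , λ ()
another (s≤s (s≤s _)) (suc _) = zero , λ ()

injective-into-point : ∀ {A : Set} {n a} (f : Fin (suc n) → A) → Injective _≡_ _≡_ f →
  (∀ k → a ≡ f k) → suc n ≡ 1
injective-into-point {n = ℕ.zero} f f-inj same = refl
injective-into-point {n = suc _}  f f-inj same
  with f-inj {zero} {suc zero} (trans (sym (same zero)) (same (suc zero)))
... | ()

2≤M : ∀ m → 2 ≤ M m
2≤M m = ≤-trans (n≤1+n 2) (m≤n⊔m m 3)

countsAtMost-mono : ∀ {m m′} → m ≤ m′ → ∀ φ → CountsAtMost m φ → CountsAtMost m′ φ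
countsAtMost-mono m≤m′ top           _         = tt
countsAtMost-mono m≤m′ (const _)     _         = tt
countsAtMost-mono m≤m′ (φ ∧ₛ ψ)      (cφ , cψ) =
  countsAtMost-mono m≤m′ φ cφ , countsAtMost-mono m≤m′ ψ cψ
countsAtMost-mono m≤m′ (φ ∨ₛ ψ)      (cφ , cψ) =
  countsAtMost-mono m≤m′ φ cφ , countsAtMost-mono m≤m′ ψ cψ
countsAtMost-mono m≤m′ (notₛ φ)      cφ        = countsAtMost-mono m≤m′ φ cφ
countsAtMost-mono m≤m′ (geq _ _ _ ψ) (n≤m , cψ) = ≤-trans n≤m m≤m′ , countsAtMost-mono m≤m′ ψ cψ
countsAtMost-mono m≤m′ (eqₛ _ _)     _         = tt
countsAtMost-mono m≤m′ (disjₛ _ _)   _         = tt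
countsAtMost-mono m≤m′ (closed _)    _         = tt

prevIdx : Fin 4 → Fin 4
prevIdx zero                   = suc (suc (suc zero))
prevIdx (suc zero)             = zero
prevIdx (suc (suc zero))       = suc zero
prevIdx (suc (suc (suc zero))) = suc (suc zero)

nextIdx-prevIdx : ∀ i → nextIdx (prevIdx i) ≡ i
nextIdx-prevIdx zero                   = refl
nextIdx-prevIdx (suc zero)             = refl
nextIdx-prevIdx (suc (suc zero))       = refl
nextIdx-prevIdx (suc (suc (suc zero))) = refl

prevIdx-nextIdx-comm : ∀ i → prevIdx (nextIdx i) ≡ nextIdx (prevIdx i)
prevIdx-nextIdx-comm zero                   = refl
prevIdx-nextIdx-comm (suc zero)             = refl
prevIdx-nextIdx-comm (suc (suc zero))       = refl
prevIdx-nextIdx-comm (suc (suc (suc zero))) = refl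

nextIdx-≢ : ∀ i → nextIdx i ≢ i
nextIdx-≢ zero                   ()
nextIdx-≢ (suc zero)             ()
nextIdx-≢ (suc (suc zero))       ()
nextIdx-≢ (suc (suc (suc zero))) ()

nextIdx²-≢ : ∀ i → nextIdx (nextIdx i) ≢ i
nextIdx²-≢ zero                   ()
nextIdx²-≢ (suc zero)             ()
nextIdx²-≢ (suc (suc zero))       ()
nextIdx²-≢ (suc (suc (suc zero))) ()

prevIdx-≢ : ∀ i → prevIdx i ≢ i
prevIdx-≢ zero                   ()
prevIdx-≢ (suc zero)             ()
prevIdx-≢ (suc (suc zero))       ()
prevIdx-≢ (suc (suc (suc zero))) ()

prevIdx≢nextIdx : ∀ i → prevIdx i ≢ nextIdx i
prevIdx≢nextIdx zero                   ()
prevIdx≢nextIdx (suc zero)             ()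
prevIdx≢nextIdx (suc (suc zero))       ()
prevIdx≢nextIdx (suc (suc (suc zero))) ()

even⊎next-even : ∀ i → EvenIdx i ⊎ EvenIdx (nextIdx i)
even⊎next-even zero                   = inj₂ (inj₁ refl)
even⊎next-even (suc zero)             = inj₁ (inj₁ refl)
even⊎next-even (suc (suc zero))       = inj₂ (inj₂ refl)
even⊎next-even (suc (suc (suc zero))) = inj₁ (inj₂ refl)

even⊎prev-even : ∀ i → EvenIdx i ⊎ EvenIdx (prevIdx i)
even⊎prev-even zero                   = inj₂ (inj₂ refl)
even⊎prev-even (suc zero)             = inj₁ (inj₁ refl)
even⊎prev-even (suc (suc zero))       = inj₂ (inj₁ refl)
even⊎prev-even (suc (suc (suc zero))) = inj₁ (inj₂ refl)

-- The layer to which the leftmost word of E (taking E* zero times) moves layer i.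
shift : Path → Fin 4 → Fin 4
shift pid      i = i
shift (pp _)   i = nextIdx i
shift (pinv _) i = prevIdx i
shift (E ∪ₚ _) i = shift E i
shift (E ∘ₚ F) i = shift F (shift E i)
shift (_ *ₚ)   i = i

shift-nextIdx : ∀ E i → shift E (nextIdx i) ≡ nextIdx (shift E i)
shift-nextIdx pid      i = refl
shift-nextIdx (pp _)   i = refl
shift-nextIdx (pinv _) i = prevIdx-nextIdx-comm i
shift-nextIdx (E ∪ₚ _) i = shift-nextIdx E i
shift-nextIdx (E ∘ₚ F) i rewrite shift-nextIdx E i = shift-nextIdx F (shift E i)
shift-nextIdx (_ *ₚ)   i = refl

-- Kinds of words in the language of a path

data Letter : Set where
  fwd bwd : Letter

-- A word is empty, a single letter, or long: of length at least two.
data WordKind : Set where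
  stay   : WordKind
  letter : Letter → WordKind
  long   : WordKind

_⨾_ : WordKind → WordKind → WordKind
stay     ⨾ k        = k
long     ⨾ _        = long
letter l ⨾ stay     = letter l
letter _ ⨾ letter _ = long
letter _ ⨾ long     = long

mutual
  HasWord : Path → WordKind → Set
  HasWord pid      stay         = ⊤
  HasWord (pp _)   (letter fwd) = ⊤
  HasWord (pinv _) (letter bwd) = ⊤
  HasWord (E ∪ₚ F) k            = HasWord E k ⊎ HasWord F k
  HasWord (E ∘ₚ F) stay         = HasWord E stay × HasWord F stay
  HasWord (E ∘ₚ F) (letter l)   =
    HasWord E stay × HasWord F (letter l) ⊎ HasWord E (letter l) × HasWord F stay
  HasWord (E ∘ₚ F) long         = HasWord E long ⊎ HasWord F long ⊎ HasLetter E × HasLetter F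
  HasWord (_ *ₚ)   stay         = ⊤
  HasWord (E *ₚ)   (letter l)   = HasWord E (letter l)
  HasWord (E *ₚ)   long         = HasWord E long ⊎ HasLetter E
  HasWord _        _            = ⊥

  HasLetter : Path → Set
  HasLetter E = Σ Letter λ l → HasWord E (letter l)

Moves : Path → Set
Moves E = HasLetter E ⊎ HasWord E long

OnlyForward : Path → Set
OnlyForward E = HasWord E (letter fwd) × ¬ HasWord E stay × ¬ HasWord E (letter bwd) × ¬ HasWord E long

mutual
  hasWord? : ∀ E k → Dec (HasWord E k)
  hasWord? pid      stay         = yes tt
  hasWord? pid      (letter _)   = no λ ()
  hasWord? pid      long         = no λ ()
  hasWord? (pp _)   stay         = no λ ()
  hasWord? (pp _)   (letter fwd) = yes tt
  hasWord? (pp _)   (letter bwd) = no λ ()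
  hasWord? (pp _)   long         = no λ ()
  hasWord? (pinv _) stay         = no λ ()
  hasWord? (pinv _) (letter fwd) = no λ ()
  hasWord? (pinv _) (letter bwd) = yes tt
  hasWord? (pinv _) long         = no λ ()
  hasWord? (E ∪ₚ F) k            = hasWord? E k ⊎-dec hasWord? F k
  hasWord? (E ∘ₚ F) stay         = hasWord? E stay ×-dec hasWord? F stay
  hasWord? (E ∘ₚ F) (letter l)   =
    hasWord? E stay ×-dec hasWord? F (letter l) ⊎-dec hasWord? E (letter l) ×-dec hasWord? F stay
  hasWord? (E ∘ₚ F) long         =
    hasWord? E long ⊎-dec hasWord? F long ⊎-dec hasLetter? E ×-dec hasLetter? F
  hasWord? (_ *ₚ)   stay         = yes tt
  hasWord? (E *ₚ)   (letter l)   = hasWord? E (letter l)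
  hasWord? (E *ₚ)   long         = hasWord? E long ⊎-dec hasLetter? E

  hasLetter? : ∀ E → Dec (HasLetter E)
  hasLetter? E = map′ (λ { (inj₁ h) → fwd , h ; (inj₂ h) → bwd , h })
                      (λ { (fwd , h) → inj₁ h ; (bwd , h) → inj₂ h })
                      (hasWord? E (letter fwd) ⊎-dec hasWord? E (letter bwd))

moves? : ∀ E → Dec (Moves E)
moves? E = hasLetter? E ⊎-dec hasWord? E long

onlyForward? : ∀ E → Dec (OnlyForward E)
onlyForward? E = hasWord? E (letter fwd) ×-dec ¬? (hasWord? E stay)
                 ×-dec ¬? (hasWord? E (letter bwd)) ×-dec ¬? (hasWord? E long)

hasWord-∘ : ∀ {E F k₁ k₂} → HasWord E k₁ → HasWord F k₂ → HasWord (E ∘ₚ F) (k₁ ⨾ k₂)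
hasWord-∘ {k₁ = stay}     {stay}     h₁ h₂ = h₁ , h₂
hasWord-∘ {k₁ = stay}     {letter _} h₁ h₂ = inj₁ (h₁ , h₂)
hasWord-∘ {k₁ = stay}     {long}     h₁ h₂ = inj₂ (inj₁ h₂)
hasWord-∘ {k₁ = long}                h₁ h₂ = inj₁ h₁
hasWord-∘ {k₁ = letter _} {stay}     h₁ h₂ = inj₂ (h₁ , h₂)
hasWord-∘ {k₁ = letter l} {letter m} h₁ h₂ = inj₂ (inj₂ ((l , h₁) , (m , h₂)))
hasWord-∘ {k₁ = letter _} {long}     h₁ h₂ = inj₂ (inj₁ h₂)

hasWord-* : ∀ {E k₁ k₂} → HasWord E k₁ → HasWord (E *ₚ) k₂ → HasWord (E *ₚ) (k₁ ⨾ k₂)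
hasWord-* {k₁ = stay}                h₁ h₂ = h₂
hasWord-* {k₁ = long}                h₁ h₂ = inj₁ h₁
hasWord-* {k₁ = letter _} {stay}     h₁ h₂ = h₁
hasWord-* {k₁ = letter l} {letter _} h₁ h₂ = inj₂ (l , h₁)
hasWord-* {k₁ = letter l} {long}     h₁ h₂ = inj₂ (l , h₁)

stay-sound : ∀ {Gr} E {a} → HasWord E stay → ⟦ Gr ⟧ E a a
stay-sound pid      _         = s-id
stay-sound (pp _)   ()
stay-sound (pinv _) ()
stay-sound (E ∪ₚ _) (inj₁ h)  = s-∪ˡ (stay-sound E h)
stay-sound (_ ∪ₚ F) (inj₂ h)  = s-∪ʳ (stay-sound F h)
stay-sound (E ∘ₚ F) (hE , hF) = s-∘ (stay-sound E hE) (stay-sound F hF)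
stay-sound (_ *ₚ)   _         = s-refl

-- Graphs whose edges stay inside a set of nodes

EdgesWithin : (Node → Set) → Graph → Set
EdgesWithin S Gr = ∀ {a q b} → Gr a q b → S a × S b

module _ {S : Node → Set} where

  path-within : ∀ {Gr E a b} → EdgesWithin S Gr → S a → ⟦ Gr ⟧ E a b → S b
  path-within W sa s-id          = sa
  path-within W sa (s-prop e)    = proj₂ (W e)
  path-within W sa (s-inv e)     = proj₁ (W e)
  path-within W sa (s-∪ˡ d)      = path-within W sa d
  path-within W sa (s-∪ʳ d)      = path-within W sa d
  path-within W sa (s-∘ d₁ d₂)   = path-within W (path-within W sa d₁) d₂
  path-within W sa s-refl        = sa
  path-within W sa (s-step d₁ d₂) = path-within W (path-within W sa d₁) d₂

  path-outside : ∀ {Gr E a b} → EdgesWithin S Gr → ¬ S a → ⟦ Gr ⟧ E a b → b ≡ a × HasWord E stay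
  path-outside W ¬sa s-id       = refl , tt
  path-outside W ¬sa (s-prop e) = ⊥-elim (¬sa (proj₁ (W e)))
  path-outside W ¬sa (s-inv e)  = ⊥-elim (¬sa (proj₂ (W e)))
  path-outside W ¬sa (s-∪ˡ d)   = map₂ inj₁ (path-outside W ¬sa d)
  path-outside W ¬sa (s-∪ʳ d)   = map₂ inj₂ (path-outside W ¬sa d)
  path-outside W ¬sa (s-∘ d₁ d₂) with path-outside W ¬sa d₁
  ... | refl , h₁ with path-outside W ¬sa d₂
  ... | refl , h₂ = refl , h₁ , h₂
  path-outside W ¬sa s-refl     = refl , tt
  path-outside W ¬sa (s-step d₁ d₂) with path-outside W ¬sa d₁
  ... | refl , _ with path-outside W ¬sa d₂
  ... | refl , _ = refl , tt

  path-transfer-outside : ∀ {Gr₁ Gr₂ E a b} → EdgesWithin S Gr₁ → ¬ S a →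
    ⟦ Gr₁ ⟧ E a b → ⟦ Gr₂ ⟧ E a b
  path-transfer-outside {E = E} W ¬sa d with path-outside W ¬sa d
  ... | refl , h = stay-sound E h

  sat-outside : ∀ {Gr₁ Gr₂ a} → EdgesWithin S Gr₁ → EdgesWithin S Gr₂ → ¬ S a →
    ∀ φ → Sat Gr₁ a φ ⇔ Sat Gr₂ a φ
  sat-outside W₁ W₂ ¬sa top           = ⇔.refl
  sat-outside W₁ W₂ ¬sa (const _)     = ⇔.refl
  sat-outside W₁ W₂ ¬sa (φ ∧ₛ ψ)      = sat-outside W₁ W₂ ¬sa φ ×-⇔ sat-outside W₁ W₂ ¬sa ψ
  sat-outside W₁ W₂ ¬sa (φ ∨ₛ ψ)      = sat-outside W₁ W₂ ¬sa φ ⊎-⇔ sat-outside W₁ W₂ ¬sa ψ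
  sat-outside W₁ W₂ ¬sa (notₛ φ)      = ¬-cong-⇔ (sat-outside W₁ W₂ ¬sa φ)
  sat-outside {a = a} W₁ W₂ ¬sa (geq _ _ E ψ) =
    mk⇔ (λ (f , f-inj , h) → f , f-inj , λ k → witness W₁ to (h k))
        (λ (f , f-inj , h) → f , f-inj , λ k → witness W₂ from (h k))
    where
    open Equivalence (sat-outside W₁ W₂ ¬sa ψ)
    witness : ∀ {G G′ b} → EdgesWithin S G → (Sat G a ψ → Sat G′ a ψ) →
      ⟦ G ⟧ E a b × Sat G b ψ → ⟦ G′ ⟧ E a b × Sat G′ b ψ
    witness W move (d , s) with path-outside W ¬sa d
    ... | refl , h = stay-sound E h , move s
  sat-outside {a = a} W₁ W₂ ¬sa (eqₛ E p) = mk⇔ (no-targets W₁ W₂) (no-targets W₂ W₁)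
    where
    no-targets : ∀ {G G′} → EdgesWithin S G → EdgesWithin S G′ →
      Sat G a (eqₛ E p) → Sat G′ a (eqₛ E p)
    no-targets W W′ sat b =
      mk⇔ (λ d → ⊥-elim (¬sa (proj₁ (W (Equivalence.to (sat b) (path-transfer-outside W′ ¬sa d))))))
          (λ e → ⊥-elim (¬sa (proj₁ (W′ e))))
  sat-outside W₁ W₂ ¬sa (disjₛ _ _)   =
    mk⇔ (λ _ _ _ e → ¬sa (proj₁ (W₂ e))) (λ _ _ _ e → ¬sa (proj₁ (W₁ e)))
  sat-outside W₁ W₂ ¬sa (closed _)    =
    mk⇔ (λ _ _ _ _ e → ¬sa (proj₁ (W₂ e))) (λ _ _ _ _ e → ¬sa (proj₁ (W₁ e)))

-- Layered graphs on a grid of four layers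

module Grid (Σ' : Vocab) (r : Prop) {w : ℕ} (x : Fin 4 → Fin w → Node) where

  InGrid : Node → Set
  InGrid a = ∃₂ λ i j → a ≡ x i j

  grid? : ∀ a → Dec (InGrid a)
  grid? a = any? λ i → any? λ j → a ≟ₙ x i j

  record IsLayered (Gr : Graph) : Set where
    field
      edge-Σ       : ∀ {a q b} → Gr a q b → inj₂ q ∈ Σ'
      edge-uniform : ∀ {a q q′ b} → inj₂ q′ ∈ Σ' → Gr a q b → Gr a q′ b
      edge-grid    : ∀ {a q b} → Gr a q b →
        ∃₂ λ i j → ∃₂ λ i′ j′ →
          a ≡ x i j × b ≡ x i′ j′ × (i′ ≡ nextIdx i ⊎ (i′ ≡ i × j ≢ j′))
      r-next       : ∀ i j j′ → Gr (x i j) r (x (nextIdx i) j′)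
      r-even       : ∀ {i j j′} → EvenIdx i → j ≢ j′ → Gr (x i j) r (x i j′)

  LayerIn : (Node → Set) → Fin 4 → Set
  LayerIn S ℓ = ∀ k → S (x ℓ k)

  record AdjacentLayersIn (S : Node → Set) : Set where
    constructor adjacent
    field
      layer      : Fin 4
      layer⊆     : LayerIn S layer
      nextLayer⊆ : LayerIn S (nextIdx layer)

  adjacentLayers-mono : ∀ {S S′ : Node → Set} → (∀ {c} → S c → S′ c) →
    AdjacentLayersIn S → AdjacentLayersIn S′
  adjacentLayers-mono S⊆S′ (adjacent ℓ here next) =
    adjacent ℓ (λ k → S⊆S′ (here k)) (λ k → S⊆S′ (next k))

  adjacentLayers-prev : ∀ {S} ℓ → LayerIn S (prevIdx ℓ) → LayerIn S ℓ → AdjacentLayersIn S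
  adjacentLayers-prev {S} ℓ prev here =
    adjacent (prevIdx ℓ) prev (subst (LayerIn S) (sym (nextIdx-prevIdx ℓ)) here)

  PropIn : List Prop → Node ⊎ Prop → Set
  PropIn R (inj₁ _) = ⊤
  PropIn R (inj₂ q) = q ∈ R

  propIn? : ∀ R s → Dec (PropIn R s)
  propIn? R (inj₁ _) = yes tt
  propIn? R (inj₂ q) = _∈?_ _≟ₚ_ q R

  -- The truth value of a shape at every grid node of every layered graph.
  Holds : Shape → Set
  Holds top           = ⊤
  Holds (const _)     = ⊥
  Holds (φ ∧ₛ ψ)      = Holds φ × Holds ψ
  Holds (φ ∨ₛ ψ)      = Holds φ ⊎ Holds ψ
  Holds (notₛ φ)      = ¬ Holds φ
  Holds (geq n _ E ψ) = Holds ψ × (Moves E ⊎ n ≡ 1)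
  Holds (eqₛ E _)     = OnlyForward E
  Holds (disjₛ _ _)   = ⊥  -- junk: excluded by NoDisj
  Holds (closed R)    = All (PropIn R) Σ'

  holds? : ∀ φ → Dec (Holds φ)
  holds? top           = yes tt
  holds? (const _)     = no λ ()
  holds? (φ ∧ₛ ψ)      = holds? φ ×-dec holds? ψ
  holds? (φ ∨ₛ ψ)      = holds? φ ⊎-dec holds? ψ
  holds? (notₛ φ)      = ¬? (holds? φ)
  holds? (geq n _ E ψ) = holds? ψ ×-dec (moves? E ⊎-dec n ℕ.≟ 1)
  holds? (eqₛ E _)     = onlyForward? E
  holds? (disjₛ _ _)   = no λ ()
  holds? (closed R)    = All.all? (propIn? R) Σ'

  module Layered (r∈Σ : inj₂ r ∈ Σ') (2≤w : 2 ≤ w)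
    (x-injective : ∀ i j i′ j′ → x i j ≡ x i′ j′ → i ≡ i′ × j ≡ j′)
    {Gr : Graph} (layered : IsLayered Gr) where

    open IsLayered layered

    edgesWithin : EdgesWithin InGrid Gr
    edgesWithin e with edge-grid e
    ... | i , j , i′ , j′ , refl , refl , _ = (i , j , refl) , (i′ , j′ , refl)

    edge-layer : ∀ {i j q i′ j′} → Gr (x i j) q (x i′ j′) →
      i′ ≡ nextIdx i ⊎ (i′ ≡ i × j ≢ j′)
    edge-layer e with edge-grid e
    ... | _ , _ , _ , _ , ea , eb , step
      with x-injective _ _ _ _ ea | x-injective _ _ _ _ eb
    ... | refl , refl | refl , refl = step

    no-loop : ∀ {i j q} → ¬ Gr (x i j) q (x i j)
    no-loop {i} e with edge-layer e
    ... | inj₁ i≡next    = nextIdx-≢ i (sym i≡next)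
    ... | inj₂ (_ , j≢j) = j≢j refl

    off-successor : ∀ {i j q ℓ k} → ℓ ≢ i → ℓ ≢ nextIdx i → ¬ Gr (x i j) q (x ℓ k)
    off-successor ℓ≢i ℓ≢next e with edge-layer e
    ... | inj₁ ℓ≡next  = ℓ≢next ℓ≡next
    ... | inj₂ (ℓ≡i , _) = ℓ≢i ℓ≡i

    r-prev : ∀ i j j′ → Gr (x (prevIdx i) j) r (x i j′)
    r-prev i j j′ =
      subst (λ i′ → Gr (x (prevIdx i) j) r (x i′ j′)) (nextIdx-prevIdx i) (r-next (prevIdx i) j j′)

    Step : Letter → Node → Node → Set
    Step fwd a b = Gr a r b
    Step bwd a b = Gr b r a

    Follows : WordKind → Node → Node → Set
    Follows stay       a b = a ≡ b
    Follows (letter l) a b = Step l a b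
    Follows long       _ _ = ⊤

    follows-⨾ : ∀ {k₁ k₂ a b c} → Follows k₁ a b → Follows k₂ b c → Follows (k₁ ⨾ k₂) a c
    follows-⨾ {stay}                 refl f₂ = f₂
    follows-⨾ {long}                 _    _  = tt
    follows-⨾ {letter _} {stay}      f₁ refl = f₁
    follows-⨾ {letter _} {letter _}  _    _  = tt
    follows-⨾ {letter _} {long}      _    _  = tt

    word-of : ∀ {E a b} → ⟦ Gr ⟧ E a b → ∃ λ k → HasWord E k × Follows k a b
    word-of s-id        = stay , tt , refl
    word-of (s-prop e)  = letter fwd , tt , edge-uniform r∈Σ e
    word-of (s-inv e)   = letter bwd , tt , edge-uniform r∈Σ e
    word-of (s-∪ˡ d)    with word-of d
    ... | k , h , f = k , inj₁ h , f
    word-of (s-∪ʳ d)    with word-of d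
    ... | k , h , f = k , inj₂ h , f
    word-of {E ∘ₚ F} (s-∘ d₁ d₂) with word-of d₁ | word-of d₂
    ... | k₁ , h₁ , f₁ | k₂ , h₂ , f₂ =
      k₁ ⨾ k₂ , hasWord-∘ {E} {F} {k₁} {k₂} h₁ h₂ , follows-⨾ {k₁} {k₂} f₁ f₂
    word-of s-refl      = stay , tt , refl
    word-of {E *ₚ} (s-step d₁ d₂) with word-of d₁ | word-of d₂
    ... | k₁ , h₁ , f₁ | k₂ , h₂ , f₂ =
      k₁ ⨾ k₂ , hasWord-* {E} {k₁} {k₂} h₁ h₂ , follows-⨾ {k₁} {k₂} f₁ f₂

    stays-put : ∀ {E a b} → ¬ Moves E → ⟦ Gr ⟧ E a b → a ≡ b
    stays-put ¬moves d with word-of d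
    ... | stay     , _ , a≡b = a≡b
    ... | letter l , h , _   = ⊥-elim (¬moves (inj₁ (l , h)))
    ... | long     , h , _   = ⊥-elim (¬moves (inj₂ h))

    letter-sound : ∀ E {l a b} → PathOver Σ' E → HasWord E (letter l) → Step l a b → ⟦ Gr ⟧ E a b
    letter-sound (pp _)   {fwd} q∈Σ _ e = s-prop (edge-uniform q∈Σ e)
    letter-sound (pinv _) {bwd} q∈Σ _ e = s-inv (edge-uniform q∈Σ e)
    letter-sound (E ∪ₚ _) (oE , _) (inj₁ h) e = s-∪ˡ (letter-sound E oE h e)
    letter-sound (_ ∪ₚ F) (_ , oF) (inj₂ h) e = s-∪ʳ (letter-sound F oF h e)
    letter-sound (E ∘ₚ F) (_ , oF) (inj₁ (hE , hF)) e = s-∘ (stay-sound E hE) (letter-sound F oF hF e)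
    letter-sound (E ∘ₚ F) (oE , _) (inj₂ (hE , hF)) e = s-∘ (letter-sound E oE hE e) (stay-sound F hF)
    letter-sound (E *ₚ)   oE h e = s-step (letter-sound E oE h e) s-refl

    path-shift : ∀ E → PathOver Σ' E → ∀ i j → ⟦ Gr ⟧ E (x i j) (x (shift E i) j)
    path-shift pid      _         i j = s-id
    path-shift (pp _)   q∈Σ       i j = s-prop (edge-uniform q∈Σ (r-next i j j))
    path-shift (pinv _) q∈Σ       i j = s-inv (edge-uniform q∈Σ (r-prev i j j))
    path-shift (E ∪ₚ _) (oE , _)  i j = s-∪ˡ (path-shift E oE i j)
    path-shift (E ∘ₚ F) (oE , oF) i j = s-∘ (path-shift E oE i j) (path-shift F oF (shift E i) j)
    path-shift (_ *ₚ)   _         i j = s-refl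

    adjacentLayers-∘ : ∀ {E F a} → PathOver Σ' F →
      AdjacentLayersIn (⟦ Gr ⟧ E a) → AdjacentLayersIn (⟦ Gr ⟧ (E ∘ₚ F) a)
    adjacentLayers-∘ {F = F} {a} oF (adjacent ℓ here next) =
      adjacent (shift F ℓ) (λ k → s-∘ (here k) (path-shift F oF ℓ k))
        (subst (LayerIn (⟦ Gr ⟧ _ a)) (shift-nextIdx F ℓ)
               (λ k → s-∘ (next k) (path-shift F oF (nextIdx ℓ) k)))

    TwoSteps : Letter → Letter → Node → Node → Set
    TwoSteps l₁ l₂ a c = ∃ λ b → Step l₁ a b × Step l₂ b c

    -- In the four cases below, one of the two layers is reached for free through the layer
    -- the first step lands in; the other goes through a non-loop edge inside an even layer,
    -- which is why a second node j′ (or k′) of the same layer is needed.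
    fwd-fwd : ∀ i j → AdjacentLayersIn (TwoSteps fwd fwd (x i j))
    fwd-fwd i j = adjacent (nextIdx i) (middle (even⊎next-even i)) far
      where
      far : LayerIn (TwoSteps fwd fwd (x i j)) (nextIdx (nextIdx i))
      far k = x (nextIdx i) j , r-next i j j , r-next (nextIdx i) j k
      middle : EvenIdx i ⊎ EvenIdx (nextIdx i) → LayerIn (TwoSteps fwd fwd (x i j)) (nextIdx i)
      middle (inj₁ ev) k =
        let (j′ , j≢j′) = another 2≤w j in x i j′ , r-even ev j≢j′ , r-next i j′ k
      middle (inj₂ ev) k =
        let (k′ , k≢k′) = another 2≤w k in x (nextIdx i) k′ , r-next i j k′ , r-even ev (≢-sym k≢k′)

    fwd-bwd : ∀ i j → AdjacentLayersIn (TwoSteps fwd bwd (x i j))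
    fwd-bwd i j = by-parity (even⊎next-even i)
      where
      own : LayerIn (TwoSteps fwd bwd (x i j)) i
      own k = x (nextIdx i) j , r-next i j j , r-next i k j
      by-parity : EvenIdx i ⊎ EvenIdx (nextIdx i) → AdjacentLayersIn (TwoSteps fwd bwd (x i j))
      by-parity (inj₁ ev) = adjacentLayers-prev i prev own
        where
        prev : LayerIn (TwoSteps fwd bwd (x i j)) (prevIdx i)
        prev k =
          let (j′ , j≢j′) = another 2≤w j in x i j′ , r-even ev j≢j′ , r-prev i k j′
      by-parity (inj₂ ev) = adjacent i own next
        where
        next : LayerIn (TwoSteps fwd bwd (x i j)) (nextIdx i)
        next k =
          let (k′ , k≢k′) = another 2≤w k in x (nextIdx i) k′ , r-next i j k′ , r-even ev k≢k′

    bwd-fwd : ∀ i j → AdjacentLayersIn (TwoSteps bwd fwd (x i j))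
    bwd-fwd i j = by-parity (even⊎prev-even i)
      where
      own : LayerIn (TwoSteps bwd fwd (x i j)) i
      own k = x (prevIdx i) j , r-prev i j j , r-prev i j k
      by-parity : EvenIdx i ⊎ EvenIdx (prevIdx i) → AdjacentLayersIn (TwoSteps bwd fwd (x i j))
      by-parity (inj₁ ev) = adjacent i own next
        where
        next : LayerIn (TwoSteps bwd fwd (x i j)) (nextIdx i)
        next k =
          let (j′ , j≢j′) = another 2≤w j in x i j′ , r-even ev (≢-sym j≢j′) , r-next i j′ k
      by-parity (inj₂ ev) = adjacentLayers-prev i prev own
        where
        prev : LayerIn (TwoSteps bwd fwd (x i j)) (prevIdx i)
        prev k =
          let (k′ , k≢k′) = another 2≤w k in x (prevIdx i) k′ , r-prev i k′ j , r-even ev (≢-sym k≢k′)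

    bwd-bwd : ∀ i j → AdjacentLayersIn (TwoSteps bwd bwd (x i j))
    bwd-bwd i j = adjacentLayers-prev (prevIdx i) far (middle (even⊎prev-even i))
      where
      far : LayerIn (TwoSteps bwd bwd (x i j)) (prevIdx (prevIdx i))
      far k = x (prevIdx i) j , r-prev i j j , r-prev (prevIdx i) k j
      middle : EvenIdx i ⊎ EvenIdx (prevIdx i) → LayerIn (TwoSteps bwd bwd (x i j)) (prevIdx i)
      middle (inj₁ ev) k =
        let (j′ , j≢j′) = another 2≤w j in x i j′ , r-even ev (≢-sym j≢j′) , r-prev i k j′
      middle (inj₂ ev) k =
        let (k′ , k≢k′) = another 2≤w k in x (prevIdx i) k′ , r-prev i k′ j , r-even ev k≢k′

    twoSteps-adjacentLayers : ∀ l₁ l₂ i j → AdjacentLayersIn (TwoSteps l₁ l₂ (x i j))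
    twoSteps-adjacentLayers fwd fwd = fwd-fwd
    twoSteps-adjacentLayers fwd bwd = fwd-bwd
    twoSteps-adjacentLayers bwd fwd = bwd-fwd
    twoSteps-adjacentLayers bwd bwd = bwd-bwd

    long⇒adjacentLayers : ∀ E → PathOver Σ' E → HasWord E long →
      ∀ i j → AdjacentLayersIn (⟦ Gr ⟧ E (x i j))
    long⇒adjacentLayers (E ∪ₚ _) (oE , _) (inj₁ h) i j =
      adjacentLayers-mono s-∪ˡ (long⇒adjacentLayers E oE h i j)
    long⇒adjacentLayers (_ ∪ₚ F) (_ , oF) (inj₂ h) i j =
      adjacentLayers-mono s-∪ʳ (long⇒adjacentLayers F oF h i j)
    long⇒adjacentLayers (E ∘ₚ F) (oE , oF) (inj₁ h) i j =
      adjacentLayers-∘ oF (long⇒adjacentLayers E oE h i j)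
    long⇒adjacentLayers (E ∘ₚ F) (oE , oF) (inj₂ (inj₁ h)) i j =
      adjacentLayers-mono (s-∘ (path-shift E oE i j)) (long⇒adjacentLayers F oF h (shift E i) j)
    long⇒adjacentLayers (E ∘ₚ F) (oE , oF) (inj₂ (inj₂ ((l₁ , h₁) , (l₂ , h₂)))) i j =
      adjacentLayers-mono (λ (_ , s₁ , s₂) → s-∘ (letter-sound E oE h₁ s₁) (letter-sound F oF h₂ s₂))
                          (twoSteps-adjacentLayers l₁ l₂ i j)
    long⇒adjacentLayers (E *ₚ) oE (inj₁ h) i j =
      adjacentLayers-mono (λ d → s-step d s-refl) (long⇒adjacentLayers E oE h i j)
    long⇒adjacentLayers (E *ₚ) oE (inj₂ (l , h)) i j =
      adjacentLayers-mono (λ (_ , s₁ , s₂) → s-step (letter-sound E oE h s₁)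
                                                    (s-step (letter-sound E oE h s₂) s-refl))
                          (twoSteps-adjacentLayers l l i j)

    moves⇒layer : ∀ E → PathOver Σ' E → Moves E → ∀ i j → ∃ λ ℓ → LayerIn (⟦ Gr ⟧ E (x i j)) ℓ
    moves⇒layer E oE (inj₁ (fwd , h)) i j = nextIdx i , λ k → letter-sound E oE h (r-next i j k)
    moves⇒layer E oE (inj₁ (bwd , h)) i j = prevIdx i , λ k → letter-sound E oE h (r-prev i k j)
    moves⇒layer E oE (inj₂ h)         i j =
      let adjacent ℓ here _ = long⇒adjacentLayers E oE h i j in ℓ , here

    adjacentLayers⇒non-successor : ∀ {S i j q} → AdjacentLayersIn S →
      ∃ λ c → S c × ¬ Gr (x i j) q c
    adjacentLayers⇒non-successor {i = i} {j} (adjacent ℓ here next) with ℓ ≟ i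
    ... | yes refl = x i j , here j , no-loop
    ... | no ℓ≢i with ℓ ≟ nextIdx i
    ...   | yes refl = x (nextIdx (nextIdx i)) j , next j , off-successor (nextIdx²-≢ i) (nextIdx-≢ (nextIdx i))
    ...   | no ℓ≢next = x ℓ j , here j , off-successor ℓ≢i ℓ≢next

    sat-eq : ∀ E {q} → PathOver Σ' E → inj₂ q ∈ Σ' →
      ∀ i j → Sat Gr (x i j) (eqₛ E q) ⇔ OnlyForward E
    sat-eq E {q} oE q∈Σ i j = mk⇔ only-forward exact
      where
      only-forward : Sat Gr (x i j) (eqₛ E q) → OnlyForward E
      only-forward sat = has-fwd , no-stay , no-bwd , no-long
        where
        edge : ∀ {b} → ⟦ Gr ⟧ E (x i j) b → Gr (x i j) q b
        edge {b} = Equivalence.to (sat b)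
        no-stay : ¬ HasWord E stay
        no-stay h = no-loop (edge (stay-sound E h))
        no-bwd : ¬ HasWord E (letter bwd)
        no-bwd h = off-successor (prevIdx-≢ i) (prevIdx≢nextIdx i) (edge (letter-sound E oE h (r-prev i j j)))
        no-long : ¬ HasWord E long
        no-long h =
          let (_ , d , ¬e) = adjacentLayers⇒non-successor (long⇒adjacentLayers E oE h i j) in ¬e (edge d)
        has-fwd : HasWord E (letter fwd)
        has-fwd with word-of (Equivalence.from (sat _) (edge-uniform q∈Σ (r-next i j j)))
        ... | stay       , h , _ = ⊥-elim (no-stay h)
        ... | letter fwd , h , _ = h
        ... | letter bwd , h , _ = ⊥-elim (no-bwd h)
        ... | long       , h , _ = ⊥-elim (no-long h)
      exact : OnlyForward E → Sat Gr (x i j) (eqₛ E q)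
      exact (has-fwd , no-stay , no-bwd , no-long) b =
        mk⇔ forward (λ e → letter-sound E oE has-fwd (edge-uniform r∈Σ e))
        where
        forward : ⟦ Gr ⟧ E (x i j) b → Gr (x i j) q b
        forward d with word-of d
        ... | stay       , h , _ = ⊥-elim (no-stay h)
        ... | letter fwd , _ , e = edge-uniform q∈Σ e
        ... | letter bwd , h , _ = ⊥-elim (no-bwd h)
        ... | long       , h , _ = ⊥-elim (no-long h)

    sat-geq : ∀ {n} (1≤n : 1 ≤ n) E ψ → PathOver Σ' E → n ≤ w →
      (∀ i j → Sat Gr (x i j) ψ ⇔ Holds ψ) →
      ∀ i j → Sat Gr (x i j) (geq n 1≤n E ψ) ⇔ Holds (geq n 1≤n E ψ)
    sat-geq {suc n} (s≤s z≤n) E ψ oE n≤w sat-ψ i j = mk⇔ criterion witnesses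
      where
      holds-ψ : ∀ {b} → ⟦ Gr ⟧ E (x i j) b → Sat Gr b ψ → Holds ψ
      holds-ψ d s with path-within edgesWithin (i , j , refl) d
      ... | i′ , j′ , refl = Equivalence.to (sat-ψ i′ j′) s
      criterion : Sat Gr (x i j) (geq (suc n) (s≤s z≤n) E ψ) → Holds (geq (suc n) (s≤s z≤n) E ψ)
      criterion (f , f-inj , h) = holds-ψ (proj₁ (h zero)) (proj₂ (h zero)) , moves⊎one (moves? E)
        where
        moves⊎one : Dec (Moves E) → Moves E ⊎ suc n ≡ 1
        moves⊎one (yes moves) = inj₁ moves
        moves⊎one (no ¬moves) = inj₂ (injective-into-point f f-inj λ k → stays-put ¬moves (proj₁ (h k)))
      witnesses : Holds (geq (suc n) (s≤s z≤n) E ψ) → Sat Gr (x i j) (geq (suc n) (s≤s z≤n) E ψ)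
      witnesses (hψ , inj₁ moves) =
        let (ℓ , layer) = moves⇒layer E oE moves i j in
        (λ k → x ℓ (inject≤ k n≤w)) ,
        (λ eq → inject≤-injective n≤w n≤w _ _ (proj₂ (x-injective _ _ _ _ eq))) ,
        λ k → layer (inject≤ k n≤w) , Equivalence.from (sat-ψ ℓ (inject≤ k n≤w)) hψ
      witnesses (hψ , inj₂ refl) =
        (λ _ → x (shift E i) j) , (λ { {zero} {zero} _ → refl }) ,
        λ _ → path-shift E oE i j , Equivalence.from (sat-ψ (shift E i) j) hψ

    sat-closed : ∀ R i j → Sat Gr (x i j) (closed R) ⇔ All (PropIn R) Σ'
    sat-closed R i j = mk⇔ covers (λ Σ⊆R p _ p∉R e → p∉R (All.lookup Σ⊆R (edge-Σ e)))
      where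
      covers : Sat Gr (x i j) (closed R) → All (PropIn R) Σ'
      covers sat = All.tabulate in-R
        where
        in-R : ∀ {s} → s ∈ Σ' → PropIn R s
        in-R {inj₁ _} _ = tt
        in-R {inj₂ q} q∈Σ with _∈?_ _≟ₚ_ q R
        ... | yes q∈R = q∈R
        ... | no q∉R  = ⊥-elim (sat q _ q∉R (edge-uniform q∈Σ (r-next i j j)))

    sat-grid : (∀ i j → inj₁ (x i j) ∉ Σ') →
      ∀ φ → ShapeOver Σ' φ → NoDisj φ → CountsAtMost w φ → ∀ i j → Sat Gr (x i j) φ ⇔ Holds φ
    sat-grid fresh top           _         _           _          i j = ⇔.refl
    sat-grid fresh (const c)     c∈Σ       _           _          i j =
      mk⇔ (λ { refl → fresh i j c∈Σ }) λ ()
    sat-grid fresh (φ ∧ₛ ψ)      (oφ , oψ) (nφ , nψ)   (cφ , cψ)  i j =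
      sat-grid fresh φ oφ nφ cφ i j ×-⇔ sat-grid fresh ψ oψ nψ cψ i j
    sat-grid fresh (φ ∨ₛ ψ)      (oφ , oψ) (nφ , nψ)   (cφ , cψ)  i j =
      sat-grid fresh φ oφ nφ cφ i j ⊎-⇔ sat-grid fresh ψ oψ nψ cψ i j
    sat-grid fresh (notₛ φ)      oφ        nφ          cφ         i j =
      ¬-cong-⇔ (sat-grid fresh φ oφ nφ cφ i j)
    sat-grid fresh (geq _ 1≤n E ψ) (oE , oψ) nψ        (n≤w , cψ) i j =
      sat-geq 1≤n E ψ oE n≤w (sat-grid fresh ψ oψ nψ cψ) i j
    sat-grid fresh (eqₛ E _)     (oE , q∈Σ) _          _          i j = sat-eq E oE q∈Σ i j
    sat-grid fresh (closed R)    _         _           _          i j = sat-closed R i j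

gdisj-layered : ∀ {Σ' r m} {x : Fin 4 → Fin (M m) → Node} → inj₂ r ∈ Σ' →
  Grid.IsLayered Σ' r x (Gdisj {Σ'} {m} x)
gdisj-layered r∈Σ = record
  { edge-Σ       = proj₁
  ; edge-uniform = λ q′∈Σ (_ , e) → q′∈Σ , e
  ; edge-grid    = λ where
      (_ , inj₁ (i , j , j′ , refl , refl))           → i , j , nextIdx i , j′ , refl , refl , inj₁ refl
      (_ , inj₂ (i , j , j′ , _ , j≢j′ , refl , refl)) → i , j , i , j′ , refl , refl , inj₂ (refl , j≢j′)
  ; r-next       = λ i j j′ → r∈Σ , inj₁ (i , j , j′ , refl , refl)
  ; r-even       = λ {i} {j} {j′} ev j≢j′ → r∈Σ , inj₂ (i , j , j′ , ev , j≢j′ , refl , refl)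
  }

gdisj′-layered : ∀ {Σ' r m} {x : Fin 4 → Fin (M m) → Node} → inj₂ r ∈ Σ' →
  Grid.IsLayered Σ' r x (Gdisj' {Σ'} {m} x)
gdisj′-layered r∈Σ = record
  { edge-Σ       = proj₁
  ; edge-uniform = λ q′∈Σ (_ , e) → q′∈Σ , e
  ; edge-grid    = λ where
      (_ , inj₁ (i , j , j′ , refl , refl))       → i , j , nextIdx i , j′ , refl , refl , inj₁ refl
      (_ , inj₂ (i , j , j′ , j≢j′ , refl , refl)) → i , j , i , j′ , refl , refl , inj₂ (refl , j≢j′)
  ; r-next       = λ i j j′ → r∈Σ , inj₁ (i , j , j′ , refl , refl)
  ; r-even       = λ {i} {j} {j′} _ j≢j′ → r∈Σ , inj₂ (i , j , j′ , j≢j′ , refl , refl)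
  }

proposition3p12 : (Σ' : Vocab) (r : Prop) → inj₂ r ∈ Σ' → (m : ℕ)
    → ((x , _ , _) : FreshNames Σ' m)
    → (φ : Shape) → ShapeOver Σ' φ → NoDisj φ → CountsAtMost m φ
    → ((∀ i j → ¬ Sat (Gdisj {Σ'} {m} x) (x i j) φ)
       ⊎ (∀ i j → Sat (Gdisj {Σ'} {m} x) (x i j) φ))
      × (∀ a → Sat (Gdisj {Σ'} {m} x) a φ ⇔ Sat (Gdisj' {Σ'} {m} x) a φ)
proposition3p12 Σ' r r∈Σ m (x , x-injective , fresh) φ over noDisj counts =
  uniform (holds? φ) , agree
  where
  open Grid Σ' r x
  G G′ : Graph
  G  = Gdisj {Σ'} {m} x
  G′ = Gdisj' {Σ'} {m} x
  module OnG  = Layered r∈Σ (2≤M m) x-injective (gdisj-layered r∈Σ)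
  module OnG′ = Layered r∈Σ (2≤M m) x-injective (gdisj′-layered r∈Σ)
  counts′ : CountsAtMost (M m) φ
  counts′ = countsAtMost-mono (m≤m⊔n m 3) φ counts
  on-grid : ∀ i j → Sat G (x i j) φ ⇔ Holds φ
  on-grid = OnG.sat-grid fresh φ over noDisj counts′
  on-grid′ : ∀ i j → Sat G′ (x i j) φ ⇔ Holds φ
  on-grid′ = OnG′.sat-grid fresh φ over noDisj counts′
  uniform : Dec (Holds φ) → (∀ i j → ¬ Sat G (x i j) φ) ⊎ (∀ i j → Sat G (x i j) φ)
  uniform (yes h) = inj₂ λ i j → Equivalence.from (on-grid i j) h
  uniform (no ¬h) = inj₁ λ i j s → ¬h (Equivalence.to (on-grid i j) s)
  agree : ∀ a → Sat G a φ ⇔ Sat G′ a φ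
  agree a with grid? a
  ... | yes (i , j , refl) = ⇔.trans (on-grid i j) (⇔.sym (on-grid′ i j))
  ... | no off             = sat-outside OnG.edgesWithin OnG′.edgesWithin off φ
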